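{- Let $p$ be a prime, $r\ge1$, $G_r=\mathbb Z/p^r\mathbb Z$, and $a\in G_r\setminus\{0\}$ with $p^{r-1}\mid a$. Put $k=p^r-2$. Let $b\in G_r$ with $p\nmid b$, let $n$ be the least nonnegative integer with $n\equiv ab^{ -1}-1\pmod{p^r}$, and let $\mathfrak M_{p,r,a}(b)=\langle a_1,\dots,a_k\rangle$ be the multiset in $G_r\setminus\{0\}$ with $a_j=b$ for $j\le n$ and $a_j=-b$ for $j\ge n+1$. Then $\sum_{j\in S}a_j\ne a$ for every subset $S\subseteq\{1,\dots,k\}$. -}

module Defs where

open import Data.Nat using (ℕ; zero; suc; _+_; _*_; _∸_; _^_; _%_; _<ᵇ_)
open import Data.Nat.Properties using (m^n≢0)
open import Data.Nat.Primality using (Prime; prime⇒nonZero)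
open import Data.Bool using (Bool; true; false; if_then_else_)
open import Data.Fin using (Fin; zero; suc; toℕ)
open import Data.Fin.Subset using (Subset)
open import Data.Vec using ([]; _∷_)

-- Reduction modulo p^r: the canonical representative in {0,…,p^r-1} of an
-- element of G_r = ℤ/p^rℤ.  Elements of G_r are represented by naturals < p^r.
reduce : (p r : ℕ) → Prime p → ℕ → ℕ
reduce p r pp x = _%_ x (p ^ r) {{m^n≢0 p r {{prime⇒nonZero pp}}}}

subsetSum : ∀ {k} → Subset k → (Fin k → ℕ) → ℕ
subsetSum {zero}  []          f = 0
subsetSum {suc k} (true ∷ S)  f = f zero + subsetSum S (λ j → f (suc j))
subsetSum {suc k} (false ∷ S) f = subsetSum S (λ j → f (suc j))

-- n = least nonnegative integer with n ≡ a b⁻¹ - 1 (mod p^r), where binv is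
-- (a representative of) b⁻¹ in G_r.
nIndex : (p r : ℕ) → Prime p → (a binv : ℕ) → ℕ
nIndex p r pp a binv = reduce p r pp (a * binv + (p ^ r ∸ 1))

-- The multiset 𝔐_{p,r,a}(b) = ⟨a_1,…,a_k⟩, k = p^r - 2, with index j : Fin k
-- standing for position toℕ j + 1:  a_j = b for j ≤ n, a_j = -b otherwise.
-- -b is represented by p^r - b.
msetElem : (p r : ℕ) → Prime p → (a b binv : ℕ) → Fin (p ^ r ∸ 2) → ℕ
msetElem p r pp a b binv j =
  if toℕ j <ᵇ nIndex p r pp a binv then b else p ^ r ∸ b

{-# OPTIONS --safe #-}
-- Write N = p^r. A subset S that picks s of the n entries equal to b and t of
-- the k − n entries equal to −b has sum (s − t)·b. If that sum were a, then
-- multiplying by b⁻¹ gives s ≡ ab⁻¹ + t ≡ n + 1 + t (mod N). But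
-- s ≤ n < n + 1 + t ≤ k + 1 = N − 1, so these are distinct residues; the extreme
-- case n + 1 = N is impossible since it forces a ≡ (n + 1)·b ≡ 0.
module Submission where

open import Defs
open import Algebra.Properties.CommutativeSemigroup using (x∙yz≈y∙xz; xy∙z≈xz∙y)
open import Data.Bool using (true; false; if_then_else_)
open import Data.Empty using (⊥-elim)
open import Data.Fin using (Fin; toℕ)
open import Data.Fin.Subset using (Subset)
open import Data.Nat
  using (ℕ; zero; suc; _+_; _*_; _∸_; _^_; _%_; _<ᵇ_; _<_; _≤_; NonZero; >-nonZero⁻¹; z≤n; s≤s)
open import Data.Nat.Divisibility using (_∣_)
open import Data.Nat.DivMod
  using (m%n%n≡m%n; %-distribˡ-+; %-distribˡ-*; [m+n]%n≡m%n; [m+kn]%n≡m%n; m<n⇒m%n≡m; m%n<n; m*n%n≡0)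
open import Data.Nat.Primality using (Prime; prime⇒nonZero)
open import Data.Nat.Properties
  using ( +-assoc; *-assoc; *-comm; *-identityʳ; *-distribˡ-+; *-distribʳ-+
        ; +-commutativeSemigroup; *-commutativeSemigroup; +-monoʳ-≤
        ; ≤-trans; ≤-reflexive; <⇒≤; ≤-<-trans; <-irrefl; m≤m+n; m≤n⇒m≤1+n
        ; m≤n⇒m<n∨m≡n; m+[n∸m]≡n; m∸n+n≡m; m^n≢0 )
open import Data.Product using (∃₂; _×_; _,_)
open import Data.Sum using (inj₁; inj₂)
open import Data.Vec using ([]; _∷_)
open import Relation.Binary.PropositionalEquality
  using (_≡_; _≢_; refl; sym; trans; cong; cong₂; module ≡-Reasoning)
open import Relation.Nullary using (¬_)

stepSeq : ∀ {k} → ℕ → ℕ → ℕ → Fin k → ℕ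
stepSeq n x y j = if toℕ j <ᵇ n then x else y

subsetSum-stepSeq : ∀ {k} (S : Subset k) n x y →
  ∃₂ λ s t → s ≤ n × t ≤ k ∸ n × subsetSum S (stepSeq n x y) ≡ s * x + t * y
subsetSum-stepSeq []          n       x y = 0 , 0 , z≤n , z≤n , refl
subsetSum-stepSeq (false ∷ S) zero    x y with subsetSum-stepSeq S zero x y
... | s , t , s≤0 , t≤k , eq = s , t , s≤0 , m≤n⇒m≤1+n t≤k , eq
subsetSum-stepSeq (true ∷ S)  zero    x y with subsetSum-stepSeq S zero x y
... | s , t , s≤0 , t≤k , eq =
  s , suc t , s≤0 , s≤s t≤k , trans (cong (y +_) eq) (x∙yz≈y∙xz +-commutativeSemigroup y (s * x) (t * y))
subsetSum-stepSeq (false ∷ S) (suc n) x y with subsetSum-stepSeq S n x y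
... | s , t , s≤n , t≤k∸n , eq = s , t , m≤n⇒m≤1+n s≤n , t≤k∸n , eq
subsetSum-stepSeq (true ∷ S)  (suc n) x y with subsetSum-stepSeq S n x y
... | s , t , s≤n , t≤k∸n , eq =
  suc s , t , s≤s s≤n , t≤k∸n , trans (cong (x +_) eq) (sym (+-assoc x (s * x) (t * y)))

suc-m+o<n : ∀ {m n o} → suc m < n → o ≤ n ∸ 2 ∸ m → suc m + o < n
suc-m+o<n {m} {suc (suc n)} {o} (s≤s (s≤s m≤n)) o≤n∸m =
  s≤s (s≤s (≤-trans (+-monoʳ-≤ m o≤n∸m) (≤-reflexive (m+[n∸m]≡n m≤n))))

module Modulo (N : ℕ) .{{_ : NonZero N}} where

  infix 4 _≋_
  _≋_ : ℕ → ℕ → Set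
  x ≋ y = x % N ≡ y % N

  +-cong : ∀ {x y u v} → x ≋ y → u ≋ v → x + u ≋ y + v
  +-cong {x} {y} {u} {v} x≋y u≋v = begin
    (x + u) % N             ≡⟨ %-distribˡ-+ x u N ⟩
    (x % N + u % N) % N     ≡⟨ cong (_% N) (cong₂ _+_ x≋y u≋v) ⟩
    (y % N + v % N) % N     ≡⟨ %-distribˡ-+ y v N ⟨
    (y + v) % N             ∎
    where open ≡-Reasoning

  *-cong : ∀ {x y u v} → x ≋ y → u ≋ v → x * u ≋ y * v
  *-cong {x} {y} {u} {v} x≋y u≋v = begin
    (x * u) % N             ≡⟨ %-distribˡ-* x u N ⟩
    (x % N * (u % N)) % N   ≡⟨ cong (_% N) (cong₂ _*_ x≋y u≋v) ⟩
    (y % N * (v % N)) % N   ≡⟨ %-distribˡ-* y v N ⟨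
    (y * v) % N             ∎
    where open ≡-Reasoning

  %-≋ : ∀ x → x % N ≋ x
  %-≋ x = m%n%n≡m%n x N

  ≋⇒≡ : ∀ {x y} → x < N → y < N → x ≋ y → x ≡ y
  ≋⇒≡ x<N y<N x≋y = trans (sym (m<n⇒m%n≡m x<N)) (trans x≋y (m<n⇒m%n≡m y<N))

  suc-[x+N∸1]%N≋x : ∀ x → suc ((x + (N ∸ 1)) % N) ≋ x
  suc-[x+N∸1]%N≋x x = begin
    (1 + (x + (N ∸ 1)) % N) % N ≡⟨ +-cong {1} refl (%-≋ (x + (N ∸ 1))) ⟩
    (1 + (x + (N ∸ 1))) % N     ≡⟨ cong (_% N) (x∙yz≈y∙xz +-commutativeSemigroup 1 x (N ∸ 1)) ⟩
    (x + (1 + (N ∸ 1))) % N     ≡⟨ cong (λ m → (x + m) % N) (m+[n∸m]≡n (>-nonZero⁻¹ N)) ⟩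
    (x + N) % N                 ≡⟨ [m+n]%n≡m%n x N ⟩
    x % N                       ∎
    where open ≡-Reasoning

  m*b≋a≢0⇒m<N : ∀ {m b a} → m ≤ N → m * b ≋ a → a < N → a ≢ 0 → m < N
  m*b≋a≢0⇒m<N {m} {b} {a} m≤N mb≋a a<N a≢0 with m≤n⇒m<n∨m≡n m≤N
  ... | inj₁ m<N = m<N
  ... | inj₂ m≡N = ⊥-elim (a≢0 (begin
    a             ≡⟨ m<n⇒m%n≡m a<N ⟨
    a % N         ≡⟨ mb≋a ⟨
    (m * b) % N   ≡⟨ cong (λ c → (c * b) % N) m≡N ⟩
    (N * b) % N   ≡⟨ cong (_% N) (*-comm N b) ⟩
    (b * N) % N   ≡⟨ m*n%n≡0 b N ⟩
    0             ∎))
    where open ≡-Reasoning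

  +-cancel-negatives : ∀ {b} → b ≤ N → ∀ x t → x + t * (N ∸ b) + t * b ≋ x
  +-cancel-negatives {b} b≤N x t = begin
    (x + t * (N ∸ b) + t * b) % N ≡⟨ cong (_% N) (+-assoc x (t * (N ∸ b)) (t * b)) ⟩
    (x + (t * (N ∸ b) + t * b)) % N ≡⟨ cong (λ m → (x + m) % N) (*-distribˡ-+ t (N ∸ b) b) ⟨
    (x + t * (N ∸ b + b)) % N       ≡⟨ cong (λ m → (x + t * m) % N) (m∸n+n≡m b≤N) ⟩
    (x + t * N) % N                 ≡⟨ [m+kn]%n≡m%n x t N ⟩
    x % N                           ∎
    where open ≡-Reasoning

  module Invertible {b b⁻¹ : ℕ} (b*b⁻¹≋1 : b * b⁻¹ ≋ 1) where

    *-inverseʳ : ∀ x → x * b * b⁻¹ ≋ x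
    *-inverseʳ x = begin
      (x * b * b⁻¹) % N   ≡⟨ cong (_% N) (*-assoc x b b⁻¹) ⟩
      (x * (b * b⁻¹)) % N ≡⟨ *-cong {x} refl b*b⁻¹≋1 ⟩
      (x * 1) % N         ≡⟨ cong (_% N) (*-identityʳ x) ⟩
      x % N               ∎
      where open ≡-Reasoning

    *-cancelʳ-≋ : ∀ {x y} → x * b ≋ y * b → x ≋ y
    *-cancelʳ-≋ {x} {y} xb≋yb = begin
      x % N               ≡⟨ *-inverseʳ x ⟨
      (x * b * b⁻¹) % N   ≡⟨ *-cong xb≋yb (refl {x = b⁻¹ % N}) ⟩
      (y * b * b⁻¹) % N   ≡⟨ *-inverseʳ y ⟩
      y % N               ∎
      where open ≡-Reasoning

    suc-[xb⁻¹-1]*b≋x : ∀ x → suc ((x * b⁻¹ + (N ∸ 1)) % N) * b ≋ x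
    suc-[xb⁻¹-1]*b≋x x = begin
      (suc ((x * b⁻¹ + (N ∸ 1)) % N) * b) % N ≡⟨ *-cong (suc-[x+N∸1]%N≋x (x * b⁻¹)) (refl {x = b % N}) ⟩
      (x * b⁻¹ * b) % N                        ≡⟨ cong (_% N) (xy∙z≈xz∙y *-commutativeSemigroup x b⁻¹ b) ⟩
      (x * b * b⁻¹) % N                        ≡⟨ *-inverseʳ x ⟩
      x % N                                    ∎
      where open ≡-Reasoning

    sum-with-negatives≢ : ∀ {a n s t Σ} → a < N → a ≢ 0 → b ≤ N →
      n < N → suc n * b ≋ a → s ≤ n → t ≤ N ∸ 2 ∸ n →
      Σ ≡ s * b + t * (N ∸ b) → Σ % N ≢ a
    sum-with-negatives≢ {a} {n} {s} {t} {Σ} a<N a≢0 b≤N n<N n+1≋a s≤n t≤k∸n Σ≡ Σ%N≡a =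
      <-irrefl refl (≤-trans (m≤m+n (suc n) t) (≤-trans (≤-reflexive n+1+t≡s) s≤n))
      where
      a≋Σ : a ≋ Σ
      a≋Σ = trans (m<n⇒m%n≡m a<N) (sym Σ%N≡a)
      n+1+t≋s : suc n + t ≋ s
      n+1+t≋s = *-cancelʳ-≋ (begin
        ((suc n + t) * b) % N                    ≡⟨ cong (_% N) (*-distribʳ-+ b (suc n) t) ⟩
        (suc n * b + t * b) % N                  ≡⟨ +-cong n+1≋a (refl {x = (t * b) % N}) ⟩
        (a + t * b) % N                          ≡⟨ +-cong a≋Σ (refl {x = (t * b) % N}) ⟩
        (Σ + t * b) % N                          ≡⟨ cong (λ m → (m + t * b) % N) Σ≡ ⟩
        (s * b + t * (N ∸ b) + t * b) % N        ≡⟨ +-cancel-negatives b≤N (s * b) t ⟩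
        (s * b) % N                              ∎)
        where open ≡-Reasoning
      n+1+t≡s : suc n + t ≡ s
      n+1+t≡s = ≋⇒≡ (suc-m+o<n (m*b≋a≢0⇒m<N n<N n+1≋a a<N a≢0) t≤k∸n) (≤-<-trans s≤n n<N) n+1+t≋s

lemma3 : (p r : ℕ) → (pp : Prime p) → 1 ≤ r →
         (a : ℕ) → a < p ^ r → a ≢ 0 → p ^ (r ∸ 1) ∣ a →
         (b : ℕ) → b < p ^ r → ¬ (p ∣ b) →
         (binv : ℕ) → reduce p r pp (b * binv) ≡ reduce p r pp 1 →
         (S : Subset (p ^ r ∸ 2)) →
         reduce p r pp (subsetSum S (msetElem p r pp a b binv)) ≢ a
lemma3 p r pp _ a a<N a≢0 _ b b<N _ binv b*binv≋1 S =
  let s , t , s≤n , t≤k∸n , Σ≡ = subsetSum-stepSeq S (nIndex p r pp a binv) b (p ^ r ∸ b)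
  in sum-with-negatives≢ a<N a≢0 (<⇒≤ b<N) (m%n<n _ (p ^ r)) (suc-[xb⁻¹-1]*b≋x a) s≤n t≤k∸n Σ≡
  where
  instance
    p^r≢0 : NonZero (p ^ r)
    p^r≢0 = m^n≢0 p r {{prime⇒nonZero pp}}
  open Modulo (p ^ r)
  open Invertible {b} {binv} b*binv≋1
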